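{- Let $j$ be a nonnegative integer and let $r,m,\ell,h,p,q$ be nonnegative integers satisfying: (i) $h<2^{\ell-2}$; (ii) $2\le m<2^\ell$; (iii) $rm=2^{\ell+1}p+2^{\ell-1}+h-j$; (iv) $(r+1)m\le 2^{\ell+1}p+5\cdot2^{\ell-2}-j$; (v) $(r+2^{\ell-2})m=2^{\ell+1}q+3\cdot2^{\ell-2}+h-j$; (vi) $\mathbf{t}_{p+1}\ne\mathbf{t}_{q+1}$. Then $\langle rm+j+1,(r+1)m+j\rangle=\langle (r+2^{\ell-2})m+j+1,(r+2^{\ell-2}+1)m+j\rangle$, and $\mathfrak{K}_j(m)\le r+2^{\ell-2}+1$.
   Context: The Thue–Morse word $\mathbf{t}=\mathbf{t}_1\mathbf{t}_2\mathbf{t}_3\cdots=0110100110010110\cdots$ is the infinite binary word whose $i$-th letter $\mathbf{t}_i$ ($i\ge 1$) is the parity of the number of 1's in the binary expansion of $i-1$. For positive integers $\alpha\le\beta$, $\langle\alpha,\beta\rangle$ denotes the word $\mathbf{t}_\alpha\mathbf{t}_{\alpha+1}\cdots\mathbf{t}_\beta$. A $k$-anti-power is a word $w^{(1)}\cdots w^{(k)}$ with $w^{(1)},\dots,w^{(k)}$ pairwise distinct words of the same length. For $j\ge0$, the $j$-fix of $\mathbf{t}$ of length $N$ is $\mathbf{t}_{j+1}\cdots\mathbf{t}_{j+N}$. For a positive integer $m$, $\mathfrak{K}_j(m)$ is the smallest positive integer $k$ such that the $j$-fix of $\mathbf{t}$ of length $km$ is not a $k$-anti-power. -}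

module Defs where

open import Data.Bool using (Bool; true; false; _xor_)
open import Data.Nat using (ℕ; zero; suc; _+_; _*_; _∸_; _<_; _≤_; _≡ᵇ_)
open import Data.Nat.DivMod using (_/_; _%_)
open import Data.List using (List; map; upTo; take; drop; length)
open import Data.Product using (_×_)
open import Relation.Binary.PropositionalEquality using (_≡_; _≢_)
open import Relation.Nullary using (¬_)

-- parity of the number of 1's in the binary expansion of n,
-- computed with fuel (fuel ≥ n suffices since n / 2 < n for n > 0)
parityAux : ℕ → ℕ → Bool
parityAux zero      n = false
parityAux (suc fuel) n = (n % 2 ≡ᵇ 1) xor parityAux fuel (n / 2)

popParity : ℕ → Bool
popParity n = parityAux n n

-- Thue–Morse word, 1-indexed: t i = parity of #1's in binary of (i - 1), i ≥ 1
t : ℕ → Bool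
t i = popParity (i ∸ 1)

⟨_,_⟩ : ℕ → ℕ → List Bool
⟨ α , β ⟩ = map (λ k → t (α + k)) (upTo (suc β ∸ α))

fix : ℕ → ℕ → List Bool
fix j N = map (λ i → t (suc j + i)) (upTo N)

-- i-th block (0-indexed) of length m of a word
block : ℕ → ℕ → List Bool → List Bool
block m i w = take m (drop (i * m) w)

AntiPower : ℕ → ℕ → List Bool → Set
AntiPower k m w =
  length w ≡ k * m ×
  (∀ i i' → i < k → i' < k → i ≢ i' → block m i w ≢ block m i' w)

IsKfrak : ℕ → ℕ → ℕ → Set
IsKfrak j m K =
  1 ≤ K × ¬ AntiPower K m (fix j (K * m)) ×
  (∀ k → 1 ≤ k → k < K → AntiPower k m (fix j (k * m)))

module Submission where

-- Put ℓ = L + 2 and Q = 2^L (the cases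
-- ℓ < 2 contradict 2 ≤ m < 2^ℓ), so the hypotheses read
--   r m + j = 8Q p + 2Q + h,   (r+1) m + j ≤ 8Q p + 5Q,   (r+Q) m + j = 8Q q + 3Q + h.
-- Writing t_{i+1} = s(i), where s is the parity of the binary digit sum:
--  * s is additive over binary concatenation: s(2^L a + u) = s(a) ⊕ s(u) for u < 2^L;
--  * hence, if s(p) ≠ s(q) and x < 3Q, then s(8Qp + 2Q + x) = s(8Qq + 3Q + x):
--    with x = cQ + u (c < 3, u < Q) both sides split off s(u), and what remains,
--    s(p) ⊕ s(2+c) and s(q) ⊕ s(3+c), agree because s(2+c) ≠ s(3+c) for c < 3;
--  * the second hypothesis gives h + m ≤ 3Q, so the length-m factors of t after
--    positions rm+j and (r+Q)m+j coincide letter by letter (first claim);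
--  * these factors are the blocks r ≠ r+Q of the j-fix of length (r+Q+1)m, so that
--    prefix is no (r+Q+1)-anti-power; being an anti-power is decidable, so the
--    least such length K = 𝔎_j(m) exists and K ≤ r+Q+1 (second claim).

open import Defs
open import Data.Bool using (Bool; true; false; _xor_)
open import Data.Bool.Properties using (xor-assoc; xor-comm; xor-identityʳ) renaming (_≟_ to Bool-≟)
open import Data.Empty using (⊥-elim)
open import Data.List using (List; _∷_; map; upTo; applyUpTo; take; drop; length)
open import Data.List.Properties using (map-upTo; ≡-dec)
open import Data.Nat
open import Data.Nat.DivMod
open import Data.Nat.Induction using (<-rec)
open import Data.Nat.Properties
open import Data.Nat.Tactic.RingSolver using (solve-∀)
open import Data.Product using (_×_; _,_; ∃-syntax)
open import Function using (_∘_)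
open import Relation.Binary.PropositionalEquality
open import Relation.Nullary using (Dec; yes; no; ¬_)
open import Relation.Nullary.Decidable using (_×-dec_; _→-dec_; ¬?; map′; decidable-stable)

parityAux-zero : ∀ fuel → parityAux fuel 0 ≡ false
parityAux-zero zero       = refl
parityAux-zero (suc fuel) = parityAux-zero fuel

half-≤ : ∀ {f n} → n ≤ suc f → n / 2 ≤ f
half-≤ {n = zero}  _    = z≤n
half-≤ {n = suc n} n≤1+f = ≤-pred (≤-trans (m/n<m (suc n) 2 (n<1+n 1)) n≤1+f)

parityAux-fuel : ∀ {f g n} → n ≤ f → n ≤ g → parityAux f n ≡ parityAux g n
parityAux-fuel {zero}  {g}     z≤n _   = sym (parityAux-zero g)
parityAux-fuel {suc f} {zero}  _   z≤n = parityAux-zero (suc f)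
parityAux-fuel {suc f} {suc g} {n} n≤f n≤g =
  cong ((n % 2 ≡ᵇ 1) xor_) (parityAux-fuel (half-≤ n≤f) (half-≤ n≤g))

popParity-step : ∀ n → popParity n ≡ (n % 2 ≡ᵇ 1) xor popParity (n / 2)
popParity-step n = trans (parityAux-fuel {n} {suc n} ≤-refl (n≤1+n n))
  (cong ((n % 2 ≡ᵇ 1) xor_) (parityAux-fuel (m/n≤m n 2) ≤-refl))

popParity-bit : ∀ b a → b < 2 → popParity (b + a * 2) ≡ (b ≡ᵇ 1) xor popParity a
popParity-bit b a b<2 = trans (popParity-step (b + a * 2))
  (cong₂ (λ x y → (x ≡ᵇ 1) xor popParity y) last-bit rest)
  where
  b%2≡b : b % 2 ≡ b
  b%2≡b = m<n⇒m%n≡m b<2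
  last-bit : (b + a * 2) % 2 ≡ b
  last-bit = trans ([m+kn]%n≡m%n b a 2) b%2≡b
  no-carry : b % 2 + a * 2 % 2 < 2
  no-carry = subst₂ (λ x y → x + y < 2) (sym b%2≡b) (sym (m*n%n≡0 a 2))
    (subst (_< 2) (sym (+-identityʳ b)) b<2)
  rest : (b + a * 2) / 2 ≡ a
  rest = trans (+-distrib-/ b (a * 2) no-carry) (cong₂ _+_ (m<n⇒m/n≡0 b<2) (m*n/n≡m a 2))

popParity-concat : ∀ L a u → u < 2 ^ L → popParity (2 ^ L * a + u) ≡ popParity a xor popParity u
popParity-concat zero a zero _ = trans (cong popParity (trans (+-identityʳ _) (+-identityʳ a)))
  (sym (xor-identityʳ (popParity a)))
popParity-concat zero a (suc u) (s≤s ())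
popParity-concat (suc L) a u u<2Q = begin
  popParity (2 ^ suc L * a + u)
    ≡⟨ cong popParity split ⟩
  popParity (b + (2 ^ L * a + u′) * 2)
    ≡⟨ popParity-bit b (2 ^ L * a + u′) b<2 ⟩
  (b ≡ᵇ 1) xor popParity (2 ^ L * a + u′)
    ≡⟨ cong ((b ≡ᵇ 1) xor_) (popParity-concat L a u′ u′<Q) ⟩
  (b ≡ᵇ 1) xor (popParity a xor popParity u′)
    ≡⟨ sym (xor-assoc (b ≡ᵇ 1) (popParity a) (popParity u′)) ⟩
  ((b ≡ᵇ 1) xor popParity a) xor popParity u′
    ≡⟨ cong (_xor popParity u′) (xor-comm (b ≡ᵇ 1) (popParity a)) ⟩
  (popParity a xor (b ≡ᵇ 1)) xor popParity u′
    ≡⟨ xor-assoc (popParity a) (b ≡ᵇ 1) (popParity u′) ⟩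
  popParity a xor ((b ≡ᵇ 1) xor popParity u′)
    ≡⟨ cong (popParity a xor_) (sym (popParity-bit b u′ b<2)) ⟩
  popParity a xor popParity (b + u′ * 2)
    ≡⟨ cong (λ x → popParity a xor popParity x) (sym (m≡m%n+[m/n]*n u 2)) ⟩
  popParity a xor popParity u ∎
  where
  open ≡-Reasoning
  b = u % 2
  u′ = u / 2
  b<2 : b < 2
  b<2 = m%n<n u 2
  u′<Q : u′ < 2 ^ L
  u′<Q = m<n*o⇒m/o<n (subst (u <_) (*-comm 2 (2 ^ L)) u<2Q)
  split : 2 ^ suc L * a + u ≡ b + (2 ^ L * a + u′) * 2
  split = trans (cong (2 ^ suc L * a +_) (m≡m%n+[m/n]*n u 2)) (regroup (2 ^ L) a b u′)
    where
    regroup : ∀ Q a b d → 2 * Q * a + (b + d * 2) ≡ b + (Q * a + d) * 2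
    regroup = solve-∀

parity-flips : ∀ c → c < 3 → popParity (2 + c) ≢ popParity (3 + c)
parity-flips 0 _ ()
parity-flips 1 _ ()
parity-flips 2 _ ()
parity-flips (suc (suc (suc c))) (s≤s (s≤s (s≤s ())))

xor-flips : ∀ {x y u v : Bool} → x ≢ y → u ≢ v → x xor u ≡ y xor v
xor-flips {true}  {true}  x≢y _   = ⊥-elim (x≢y refl)
xor-flips {false} {false} x≢y _   = ⊥-elim (x≢y refl)
xor-flips {u = true}  {true}  _ u≢v = ⊥-elim (u≢v refl)
xor-flips {u = false} {false} _ u≢v = ⊥-elim (u≢v refl)
xor-flips {true}  {false} {true}  {false} _ _ = refl
xor-flips {true}  {false} {false} {true}  _ _ = refl
xor-flips {false} {true}  {true}  {false} _ _ = refl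
xor-flips {false} {true}  {false} {true}  _ _ = refl

shifted-coincidence : ∀ L p q x → popParity p ≢ popParity q → x < 3 * 2 ^ L →
  popParity (8 * 2 ^ L * p + 2 * 2 ^ L + x) ≡ popParity (8 * 2 ^ L * q + 3 * 2 ^ L + x)
shifted-coincidence L p q x p≢q x<3Q = begin
  popParity (8 * Q * p + 2 * Q + x)
    ≡⟨ split-off-low p 2 (≤-trans (+-monoʳ-< 2 c<3) (m≤m+n 5 3)) ⟩
  (popParity p xor popParity (2 + c)) xor popParity u
    ≡⟨ cong (_xor popParity u) (xor-flips p≢q (parity-flips c c<3)) ⟩
  (popParity q xor popParity (3 + c)) xor popParity u
    ≡⟨ sym (split-off-low q 3 (≤-trans (+-monoʳ-< 3 c<3) (m≤m+n 6 2))) ⟩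
  popParity (8 * Q * q + 3 * Q + x) ∎
  where
  open ≡-Reasoning
  Q = 2 ^ L
  instance _ = m^n≢0 2 L
  c = x / Q
  u = x % Q
  c<3 : c < 3
  c<3 = m<n*o⇒m/o<n x<3Q
  -- Write x = cQ + u; the prefix 8a + (d + c) and the low part u separate.
  split-off-low : ∀ a d → d + c < 8 →
    popParity (8 * Q * a + d * Q + x) ≡ (popParity a xor popParity (d + c)) xor popParity u
  split-off-low a d d+c<8 = begin
    popParity (8 * Q * a + d * Q + x)
      ≡⟨ cong popParity (trans (cong (8 * Q * a + d * Q +_) (m≡m%n+[m/n]*n x Q))
                               (regroup Q a d c u)) ⟩
    popParity (Q * (8 * a + (d + c)) + u)
      ≡⟨ popParity-concat L (8 * a + (d + c)) u (m%n<n x Q) ⟩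
    popParity (8 * a + (d + c)) xor popParity u
      ≡⟨ cong (_xor popParity u) (popParity-concat 3 a (d + c) d+c<8) ⟩
    (popParity a xor popParity (d + c)) xor popParity u ∎
    where
    regroup : ∀ Q a d c u → 8 * Q * a + d * Q + (u + c * Q) ≡ Q * (8 * a + (d + c)) + u
    regroup = solve-∀

applyUpTo-cong : ∀ {A : Set} {f g : ℕ → A} n → (∀ k → k < n → f k ≡ g k) →
  applyUpTo f n ≡ applyUpTo g n
applyUpTo-cong zero    _   = refl
applyUpTo-cong (suc n) f≗g =
  cong₂ _∷_ (f≗g 0 z<s) (applyUpTo-cong n (λ k k<n → f≗g (suc k) (s<s k<n)))

drop-applyUpTo : ∀ {A : Set} (f : ℕ → A) a n →
  drop a (applyUpTo f (a + n)) ≡ applyUpTo (λ k → f (a + k)) n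
drop-applyUpTo f zero    n = refl
drop-applyUpTo f (suc a) n = drop-applyUpTo (f ∘ suc) a n

take-applyUpTo : ∀ {A : Set} (f : ℕ → A) m n → take m (applyUpTo f (m + n)) ≡ applyUpTo f m
take-applyUpTo f zero    n = refl
take-applyUpTo f (suc m) n = cong (f 0 ∷_) (take-applyUpTo (f ∘ suc) m n)

factor : ℕ → ℕ → List Bool
factor a m = applyUpTo (λ k → t (a + 1 + k)) m

range-factor : ∀ a m → ⟨ a + 1 , a + m ⟩ ≡ factor a m
range-factor a m = trans (map-upTo (λ k → t (a + 1 + k)) (suc (a + m) ∸ (a + 1)))
                         (cong (factor a) length-eq)
  where
  length-eq : suc (a + m) ∸ (a + 1) ≡ m
  length-eq = trans (cong (_∸ (a + 1)) (trans (sym (+-suc a m)) (sym (+-assoc a 1 m)))) (m+n∸m≡n (a + 1) m)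

block-fix : ∀ j m K i → i < K → block m i (fix j (K * m)) ≡ factor (i * m + j) m
block-fix j m K i i<K = begin
  take m (drop (i * m) (map F (upTo (K * m))))
    ≡⟨ cong (λ w → take m (drop (i * m) w)) (map-upTo F (K * m)) ⟩
  take m (drop (i * m) (applyUpTo F (K * m)))
    ≡⟨ cong (λ n → take m (drop (i * m) (applyUpTo F n))) K*m≡ ⟩
  take m (drop (i * m) (applyUpTo F (i * m + (m + d))))
    ≡⟨ cong (take m) (drop-applyUpTo F (i * m) (m + d)) ⟩
  take m (applyUpTo (λ k → F (i * m + k)) (m + d))
    ≡⟨ take-applyUpTo (λ k → F (i * m + k)) m d ⟩
  applyUpTo (λ k → F (i * m + k)) m
    ≡⟨ applyUpTo-cong m (λ k _ → cong t (reindex i m j k)) ⟩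
  factor (i * m + j) m ∎
  where
  open ≡-Reasoning
  F : ℕ → Bool
  F x = t (suc j + x)
  d = K * m ∸ (i * m + m)
  block-inside : i * m + m ≤ K * m
  block-inside = subst (_≤ K * m) (+-comm m (i * m)) (*-monoˡ-≤ m i<K)
  K*m≡ : K * m ≡ i * m + (m + d)
  K*m≡ = trans (sym (m+[n∸m]≡n block-inside)) (+-assoc (i * m) m d)
  reindex : ∀ i m j k → suc j + (i * m + k) ≡ i * m + j + 1 + k
  reindex = solve-∀

antiPower? : ∀ k m w → Dec (AntiPower k m w)
antiPower? k m w = (length w ≟ k * m) ×-dec map′ curried uncurried
  (allUpTo? (λ i → allUpTo? (distinct? i) k) k)
  where
  Distinct : ℕ → ℕ → Set
  Distinct i i′ = i ≢ i′ → block m i w ≢ block m i′ w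
  distinct? : ∀ i i′ → Dec (Distinct i i′)
  distinct? i i′ = ¬? (i ≟ i′) →-dec ¬? (≡-dec Bool-≟ (block m i w) (block m i′ w))
  curried : (∀ {i} → i < k → ∀ {i′} → i′ < k → Distinct i i′) →
            ∀ i i′ → i < k → i′ < k → Distinct i i′
  curried all i i′ i<k i′<k = all i<k i′<k
  uncurried : (∀ i i′ → i < k → i′ < k → Distinct i i′) →
              ∀ {i} → i < k → ∀ {i′} → i′ < k → Distinct i i′
  uncurried all i<k i′<k = all _ _ i<k i′<k

least-witness : ∀ {P : ℕ → Set} → (∀ n → Dec (P n)) →
  ∀ N → P N → ∃[ K ] (K ≤ N × P K × (∀ k → k < K → ¬ P k))
least-witness {P} P? = <-rec Goal search
  where
  Goal : ℕ → Set
  Goal N = P N → ∃[ K ] (K ≤ N × P K × (∀ k → k < K → ¬ P k))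
  search : ∀ N → (∀ {n} → n < N → Goal n) → Goal N
  search N smaller PN with anyUpTo? P? N
  ... | yes (n , n<N , Pn) =
    let (K , K≤n , PK , K-least) = smaller n<N Pn in K , ≤-trans K≤n (<⇒≤ n<N) , PK , K-least
  ... | no none = N , ≤-refl , PN , λ k k<N Pk → none (k , k<N , Pk)

Kfrak-≤ : ∀ j m N → 1 ≤ N → ¬ AntiPower N m (fix j (N * m)) → ∃[ K ] (IsKfrak j m K × K ≤ N)
Kfrak-≤ j m N 1≤N not-AP with least-witness Bad? N (1≤N , not-AP)
  where
  Bad : ℕ → Set
  Bad k = 1 ≤ k × ¬ AntiPower k m (fix j (k * m))
  Bad? : ∀ k → Dec (Bad k)
  Bad? k = (1 ≤? k) ×-dec ¬? (antiPower? k m (fix j (k * m)))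
... | K , K≤N , (1≤K , not-AP-K) , K-least =
  K , (1≤K , not-AP-K , λ k 1≤k k<K →
         decidable-stable (antiPower? k m (fix j (k * m))) (λ not-AP-k → K-least k k<K (1≤k , not-AP-k)))
    , K≤N

t-suc : ∀ n → t (n + 1) ≡ popParity n
t-suc n = cong popParity (m+n∸n≡m n 1)

t-shift : ∀ a k → t (a + 1 + k) ≡ popParity (a + k)
t-shift a k = cong (λ n → popParity (n ∸ 1)) (trans (+-assoc a 1 k) (+-suc a k))

factors-coincide : ∀ L h m p q a₁ a₂ → popParity p ≢ popParity q →
  a₁ ≡ 8 * 2 ^ L * p + 2 * 2 ^ L + h → a₂ ≡ 8 * 2 ^ L * q + 3 * 2 ^ L + h →
  h + m ≤ 3 * 2 ^ L → factor a₁ m ≡ factor a₂ m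
factors-coincide L h m p q _ _ p≢q refl refl h+m≤3Q = applyUpTo-cong m same-letter
  where
  A₁ = 8 * 2 ^ L * p + 2 * 2 ^ L
  A₂ = 8 * 2 ^ L * q + 3 * 2 ^ L
  same-letter : ∀ k → k < m → t (A₁ + h + 1 + k) ≡ t (A₂ + h + 1 + k)
  same-letter k k<m = begin
    t (A₁ + h + 1 + k)    ≡⟨ t-shift (A₁ + h) k ⟩
    popParity (A₁ + h + k)  ≡⟨ cong popParity (+-assoc A₁ h k) ⟩
    popParity (A₁ + (h + k))
      ≡⟨ shifted-coincidence L p q (h + k) p≢q (<-≤-trans (+-monoʳ-< h k<m) h+m≤3Q) ⟩
    popParity (A₂ + (h + k))  ≡⟨ cong popParity (sym (+-assoc A₂ h k)) ⟩
    popParity (A₂ + h + k)  ≡⟨ sym (t-shift (A₂ + h) k) ⟩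
    t (A₂ + h + 1 + k) ∎
    where open ≡-Reasoning

equal-blocks-not-anti-power : ∀ j m N i i′ → i < i′ → i′ < N →
  factor (i * m + j) m ≡ factor (i′ * m + j) m → ¬ AntiPower N m (fix j (N * m))
equal-blocks-not-anti-power j m N i i′ i<i′ i′<N same (_ , distinct) =
  distinct i i′ i<N i′<N (<⇒≢ i<i′)
    (trans (block-fix j m N i i<N) (trans same (sym (block-fix j m N i′ i′<N))))
  where
  i<N : i < N
  i<N = <-trans i<i′ i′<N

2^[L+3] : ∀ L → 2 ^ (suc (suc L) + 1) ≡ 8 * 2 ^ L
2^[L+3] L = trans (cong (2 ^_) (+-comm (suc (suc L)) 1)) (eight (2 ^ L))
  where
  eight : ∀ Q → 2 * (2 * (2 * Q)) ≡ 8 * Q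
  eight = solve-∀

next-block : ∀ i m j → (i + 1) * m + j ≡ i * m + j + m
next-block = solve-∀

window-fits : ∀ L h m p a → a ≡ 8 * 2 ^ L * p + 2 * 2 ^ L + h →
  a + m ≤ 8 * 2 ^ L * p + 5 * 2 ^ L → h + m ≤ 3 * 2 ^ L
window-fits L h m p a refl a+m≤ =
  +-cancelˡ-≤ A (h + m) (3 * 2 ^ L) (subst₂ _≤_ (+-assoc A h m) (five (2 ^ L) p) a+m≤)
  where
  A = 8 * 2 ^ L * p + 2 * 2 ^ L
  five : ∀ Q p → 8 * Q * p + 5 * Q ≡ 8 * Q * p + 2 * Q + 3 * Q
  five = solve-∀

range-block : ∀ i m j → ⟨ i * m + j + 1 , (i + 1) * m + j ⟩ ≡ factor (i * m + j) m
range-block i m j = trans (cong ⟨ i * m + j + 1 ,_⟩ (next-block i m j)) (range-factor (i * m + j) m)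

mainTheorem19 : (j r m ℓ h p q : ℕ) →
    h < 2 ^ (ℓ ∸ 2) →
    2 ≤ m → m < 2 ^ ℓ →
    r * m + j ≡ 2 ^ (ℓ + 1) * p + 2 ^ (ℓ ∸ 1) + h →
    (r + 1) * m + j ≤ 2 ^ (ℓ + 1) * p + 5 * 2 ^ (ℓ ∸ 2) →
    (r + 2 ^ (ℓ ∸ 2)) * m + j ≡ 2 ^ (ℓ + 1) * q + 3 * 2 ^ (ℓ ∸ 2) + h →
    t (p + 1) ≢ t (q + 1) →
    (⟨ r * m + j + 1 , (r + 1) * m + j ⟩
       ≡ ⟨ (r + 2 ^ (ℓ ∸ 2)) * m + j + 1 , (r + 2 ^ (ℓ ∸ 2) + 1) * m + j ⟩)
    × (∃[ K ] (IsKfrak j m K × K ≤ r + 2 ^ (ℓ ∸ 2) + 1))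
mainTheorem19 j r m zero          h p q _ (s≤s (s≤s _)) (s≤s ()) _ _ _ _
mainTheorem19 j r m (suc zero)    h p q _ (s≤s (s≤s _)) (s≤s (s≤s ())) _ _ _ _
mainTheorem19 j r m (suc (suc L)) h p q _ _ _ start₁ end₁ start₂ t-p≢t-q =
  equal-factors , Kfrak-≤ j m N (m≤n+m 1 (r + Q)) not-anti-power
  where
  Q = 2 ^ L
  N = r + Q + 1
  8Q : ∀ (f : ℕ → ℕ) → f (2 ^ (suc (suc L) + 1)) ≡ f (8 * Q)
  8Q f = cong f (2^[L+3] L)
  start₁′ : r * m + j ≡ 8 * Q * p + 2 * Q + h
  start₁′ = trans start₁ (8Q (λ P → P * p + 2 * Q + h))
  start₂′ : (r + Q) * m + j ≡ 8 * Q * q + 3 * Q + h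
  start₂′ = trans start₂ (8Q (λ P → P * q + 3 * Q + h))
  end₁′ : r * m + j + m ≤ 8 * Q * p + 5 * Q
  end₁′ = subst₂ _≤_ (next-block r m j) (8Q (λ P → P * p + 5 * Q)) end₁
  p≢q : popParity p ≢ popParity q
  p≢q eq = t-p≢t-q (trans (t-suc p) (trans eq (sym (t-suc q))))
  same : factor (r * m + j) m ≡ factor ((r + Q) * m + j) m
  same = factors-coincide L h m p q _ _ p≢q start₁′ start₂′ (window-fits L h m p _ start₁′ end₁′)
  equal-factors : ⟨ r * m + j + 1 , (r + 1) * m + j ⟩ ≡ ⟨ (r + Q) * m + j + 1 , (r + Q + 1) * m + j ⟩
  equal-factors = trans (range-block r m j) (trans same (sym (range-block (r + Q) m j)))
  not-anti-power : ¬ AntiPower N m (fix j (N * m))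
  not-anti-power = equal-blocks-not-anti-power j m N r (r + Q)
    (m<m+n r (m^n>0 2 L)) (m<m+n (r + Q) z<s) same
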